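{- Let $\mathcal{T}$ be a theory, let $\boldsymbol{\alpha}$ be a finite set of atoms, and let $\varphi,\varphi_1,\varphi_2$ be quantifier-free $\mathcal{T}$-formulas whose atoms all belong to $\boldsymbol{\alpha}$ and which are $\mathcal{T}$-extended with respect to $\boldsymbol{\alpha}$. Let $\gamma$ be a cube on $\boldsymbol{\alpha}$. Then: (a) $\varphi$ is $\mathcal{T}$-valid if and only if it is propositionally valid; (b) $\gamma\models_{\mathcal{T}}\varphi$ if and only if $\gamma\models_p\varphi$; (c) $\varphi_1\equiv_{\mathcal{T}}\varphi_2$ if and only if $\varphi_1\equiv_{\mathcal{B}}\varphi_2$; (d) $\varphi_1\models_{\mathcal{T}}\varphi_2$ if and only if $\varphi_1\models_p\varphi_2$.
   Context: $\mathcal{T}$-formulas are quantifier-free first-order formulas built by Boolean connectives from $\mathcal{T}$-atoms and Boolean atoms; no atom is $\mathcal{T}$-valid or $\mathcal{T}$-inconsistent. The Boolean abstraction $\mathcal{T}2\mathcal{B}$ maps Boolean atoms to themselves and each $\mathcal{T}$-atom bijectively to a fresh Boolean variable, homomorphically on formulas; $\varphi^p=\mathcal{T}2\mathcal{B}(\varphi)$. $\varphi\models_p\psi$ iff $\varphi^p\models\psi^p$; $\equiv_{\mathcal{B}}$ is mutual $\models_p$; propositional validity of $\varphi$ means validity of $\varphi^p$. $\models_{\mathcal{T}}$, $\equiv_{\mathcal{T}}$ denote entailment/equivalence modulo $\mathcal{T}$. A cube is a conjunction of literals. A total truth assignment on $\boldsymbol{\alpha}$ is a conjunction containing, for each $a\in\boldsymbol{\alpha}$,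 exactly one of $a,\neg a$. $P_{\boldsymbol{\alpha}}(\psi)$ is the set of $\mathcal{T}$-unsatisfiable total truth assignments $\rho$ on $\boldsymbol{\alpha}$ with $\rho\models_p\psi$. $\varphi$ is $\mathcal{T}$-extended with respect to $\boldsymbol{\alpha}$ iff $P_{\boldsymbol{\alpha}}(\neg\varphi)=\emptyset$. -}

module Defs where

open import Data.Bool using (Bool; true; false; T; not; _∧_; _∨_)
open import Data.List using (List; []; _∷_; foldr; _++_)
open import Data.List.Membership.Propositional using (_∈_)
open import Data.List.Relation.Unary.All using (All)
open import Data.Product using (_×_; _,_; ∃; proj₁)
open import Relation.Nullary using (¬_)

-- Quantifier-free formulas built by Boolean connectives over a type A of atoms
-- (A contains both the T-atoms and the Boolean atoms).
data Formula (A : Set) : Set where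
  atom : A → Formula A
  ⊤ᶠ ⊥ᶠ : Formula A
  ¬ᶠ_ : Formula A → Formula A
  _∧ᶠ_ _∨ᶠ_ _⇒ᶠ_ _⇔ᶠ_ : Formula A → Formula A → Formula A

module _ {A : Set} where

  atoms : Formula A → List A
  atoms (atom a) = a ∷ []
  atoms ⊤ᶠ = []
  atoms ⊥ᶠ = []
  atoms (¬ᶠ φ) = atoms φ
  atoms (φ ∧ᶠ ψ) = atoms φ ++ atoms ψ
  atoms (φ ∨ᶠ ψ) = atoms φ ++ atoms ψ
  atoms (φ ⇒ᶠ ψ) = atoms φ ++ atoms ψ
  atoms (φ ⇔ᶠ ψ) = atoms φ ++ atoms ψ

  eval : (A → Bool) → Formula A → Bool
  eval v (atom a) = v a
  eval v ⊤ᶠ = true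
  eval v ⊥ᶠ = false
  eval v (¬ᶠ φ) = not (eval v φ)
  eval v (φ ∧ᶠ ψ) = eval v φ ∧ eval v ψ
  eval v (φ ∨ᶠ ψ) = eval v φ ∨ eval v ψ
  eval v (φ ⇒ᶠ ψ) = not (eval v φ) ∨ eval v ψ
  eval v (φ ⇔ᶠ ψ) = (eval v φ ∧ eval v ψ) ∨ (not (eval v φ) ∧ not (eval v ψ))

  -- T2B maps every atom bijectively to a fresh Boolean variable, so
  -- φ^p ⊨ ψ^p is exactly: every truth assignment to the atoms that makes
  -- φ true makes ψ true.

  _⊨ₚ_ : Formula A → Formula A → Set
  φ ⊨ₚ ψ = ∀ (v : A → Bool) → T (eval v φ) → T (eval v ψ)

  _≡ᴮ_ : Formula A → Formula A → Set
  φ ≡ᴮ ψ = (φ ⊨ₚ ψ) × (ψ ⊨ₚ φ)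

  PropValid : Formula A → Set
  PropValid φ = ∀ (v : A → Bool) → T (eval v φ)

  literal : A → Bool → Formula A
  literal a true = atom a
  literal a false = ¬ᶠ atom a

  cube : List (A × Bool) → Formula A
  cube = foldr (λ l acc → literal (proj₁ l) (Data.Product.proj₂ l) ∧ᶠ acc) ⊤ᶠ

  CubeOn : List A → List (A × Bool) → Set
  CubeOn α ls = All (λ l → proj₁ l ∈ α) ls

  totalAssignment : List A → (A → Bool) → Formula A
  totalAssignment α b = foldr (λ a acc → literal a (b a) ∧ᶠ acc) ⊤ᶠ α

-- A theory T, presented semantically through its models: each T-model
-- determines the truth value of every atom.
record Theory (A : Set) : Set₁ where
  field
    Model : Set
    holds : Model → A → Bool

module _ {A : Set} (𝒯 : Theory A) where
  open Theory 𝒯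

  _⊨ᴹ_ : Model → Formula A → Set
  M ⊨ᴹ φ = T (eval (holds M) φ)

  TValid : Formula A → Set
  TValid φ = ∀ M → M ⊨ᴹ φ

  TSatisfiable : Formula A → Set
  TSatisfiable φ = ∃ λ M → M ⊨ᴹ φ

  TUnsat : Formula A → Set
  TUnsat φ = ¬ TSatisfiable φ

  TEntails : Formula A → Formula A → Set
  TEntails φ ψ = ∀ M → M ⊨ᴹ φ → M ⊨ᴹ ψ

  TEquiv : Formula A → Formula A → Set
  TEquiv φ ψ = TEntails φ ψ × TEntails ψ φ

  -- ρ ∈ P_α(ψ), where ρ is the total truth assignment on α given by b
  InP : List A → Formula A → (A → Bool) → Set
  InP α ψ b = TUnsat (totalAssignment α b) × (totalAssignment α b ⊨ₚ ψ)

  -- φ is T-extended w.r.t. α iff P_α(¬φ) = ∅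
  TExtended : List A → Formula A → Set
  TExtended α φ = ∀ (b : A → Bool) → ¬ InP α (¬ᶠ φ) b

  NoTrivialAtoms : Set
  NoTrivialAtoms = ∀ (a : A) → ¬ TValid (atom a) × ¬ TUnsat (atom a)

-- If v falsifies χ, the total truth assignment ρ that v induces on α propositionally
-- entails ¬χ, because every atom of χ lies in α.  As χ is T-extended, ρ is then
-- T-satisfiable, i.e. some T-model agrees with v on α.  When also the atoms of ψ lie
-- in α, that model satisfies ψ whenever v does and falsifies χ, so T-entailment
-- ψ ⊨_T χ yields propositional entailment ψ ⊨ₚ χ; the converse holds for any theory.
-- Validity is entailment from ⊤ᶠ and equivalence is entailment both ways.
module Submission where

open import Defs
open import Data.Bool using (Bool; true; false; T; not; _∧_; _∨_)
open import Data.Bool.Properties using (T-∧)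
open import Data.List using (List; []; _∷_)
open import Data.List.Membership.Propositional using (_∈_)
open import Data.List.Relation.Binary.Subset.Propositional using (_⊆_)
open import Data.List.Relation.Binary.Subset.Propositional.Properties
  using (xs⊆xs++ys; xs⊆ys++xs)
open import Data.List.Relation.Unary.All using (All; []; _∷_; lookup)
open import Data.List.Relation.Unary.Any using (here; there)
open import Data.Product using (_×_; _,_; proj₁; proj₂; ∃)
open import Function.Bundles using (_⇔_; mk⇔; Equivalence)
open import Relation.Binary.PropositionalEquality using (_≡_; refl; sym; cong; cong₂; subst)
open import Relation.Nullary using (¬_)
open import Relation.Nullary.Decidable using (decidable-stable; T?)

module _ {A : Set} where

  Agree : List A → (A → Bool) → (A → Bool) → Set
  Agree xs v w = ∀ {a} → a ∈ xs → v a ≡ w a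

  agree-⊆ : ∀ {xs ys v w} → xs ⊆ ys → Agree ys v w → Agree xs v w
  agree-⊆ xs⊆ys agree a∈xs = agree (xs⊆ys a∈xs)

  eval-cong : ∀ {v w} (φ : Formula A) → Agree (atoms φ) v w → eval v φ ≡ eval w φ
  eval-cong (atom a) agree = agree (here refl)
  eval-cong ⊤ᶠ agree = refl
  eval-cong ⊥ᶠ agree = refl
  eval-cong (¬ᶠ φ) agree = cong not (eval-cong φ agree)
  eval-cong (φ ∧ᶠ ψ) agree = cong₂ _∧_
    (eval-cong φ (agree-⊆ (xs⊆xs++ys _ _) agree)) (eval-cong ψ (agree-⊆ (xs⊆ys++xs _ (atoms φ)) agree))
  eval-cong (φ ∨ᶠ ψ) agree = cong₂ _∨_
    (eval-cong φ (agree-⊆ (xs⊆xs++ys _ _) agree)) (eval-cong ψ (agree-⊆ (xs⊆ys++xs _ (atoms φ)) agree))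
  eval-cong (φ ⇒ᶠ ψ) agree = cong₂ (λ x y → not x ∨ y)
    (eval-cong φ (agree-⊆ (xs⊆xs++ys _ _) agree)) (eval-cong ψ (agree-⊆ (xs⊆ys++xs _ (atoms φ)) agree))
  eval-cong (φ ⇔ᶠ ψ) agree = cong₂ (λ x y → (x ∧ y) ∨ (not x ∧ not y))
    (eval-cong φ (agree-⊆ (xs⊆xs++ys _ _) agree)) (eval-cong ψ (agree-⊆ (xs⊆ys++xs _ (atoms φ)) agree))

  eval-cong-on : ∀ {α v w} (φ : Formula A) → All (_∈ α) (atoms φ) → Agree α v w →
    eval v φ ≡ eval w φ
  eval-cong-on φ φ⊆α agree = eval-cong φ (λ a∈φ → agree (lookup φ⊆α a∈φ))

  cube-atoms : ∀ {α} {γ : List (A × Bool)} → CubeOn α γ → All (_∈ α) (atoms (cube γ))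
  cube-atoms [] = []
  cube-atoms {γ = (a , true) ∷ γ} (a∈α ∷ γ-on) = a∈α ∷ cube-atoms γ-on
  cube-atoms {γ = (a , false) ∷ γ} (a∈α ∷ γ-on) = a∈α ∷ cube-atoms γ-on

  literal-sound : ∀ (a : A) s w → T (eval w (literal a s)) → s ≡ w a
  literal-sound a true w lit with w a
  ... | true = refl
  literal-sound a false w lit with w a
  ... | false = refl

  totalAssignment-sound : ∀ α v w → T (eval w (totalAssignment α v)) → Agree α v w
  totalAssignment-sound (a ∷ α) v w ρ (here refl) =
    literal-sound a (v a) w (proj₁ (Equivalence.to T-∧ ρ))
  totalAssignment-sound (a ∷ α) v w ρ (there a∈α) =
    totalAssignment-sound α v w (proj₂ (Equivalence.to T-∧ ρ)) a∈α

module _ {A : Set} (𝒯 : Theory A) where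
  open Theory 𝒯

  agreeing-model : ∀ {α} (χ : Formula A) → All (_∈ α) (atoms χ) → TExtended 𝒯 α χ →
    ∀ v → ¬ T (eval v χ) → ¬ ¬ ∃ (λ M → Agree α v (holds M))
  agreeing-model {α} χ χ⊆α χ-ext v ¬χ no-model = χ-ext v (ρ-unsat , ρ⊨¬χ)
    where
      ρ-unsat : TUnsat 𝒯 (totalAssignment α v)
      ρ-unsat (M , ρ) = no-model (M , totalAssignment-sound α v (holds M) ρ)

      ρ⊨¬χ : totalAssignment α v ⊨ₚ (¬ᶠ χ)
      ρ⊨¬χ w ρ with eval w χ | eval-cong-on χ χ⊆α (totalAssignment-sound α v w ρ)
      ... | false | _ = _
      ... | true  | v⊨χ = ¬χ (subst T (sym v⊨χ) _)

  ⊨ₚ⇒TEntails : ∀ (ψ χ : Formula A) → ψ ⊨ₚ χ → TEntails 𝒯 ψ χ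
  ⊨ₚ⇒TEntails ψ χ ψ⊨χ M = ψ⊨χ (holds M)

  TEntails⇒⊨ₚ : ∀ {α} (ψ χ : Formula A) → All (_∈ α) (atoms ψ) → All (_∈ α) (atoms χ) →
    TExtended 𝒯 α χ → TEntails 𝒯 ψ χ → ψ ⊨ₚ χ
  TEntails⇒⊨ₚ ψ χ ψ⊆α χ⊆α χ-ext ψ⊨χ v vψ =
    decidable-stable (T? (eval v χ)) λ ¬χ →
      agreeing-model χ χ⊆α χ-ext v ¬χ λ (M , agree) →
        ¬χ (subst T (sym (eval-cong-on χ χ⊆α agree))
             (ψ⊨χ M (subst T (eval-cong-on ψ ψ⊆α agree) vψ)))

  TEntails⇔⊨ₚ : ∀ {α} (ψ χ : Formula A) → All (_∈ α) (atoms ψ) → All (_∈ α) (atoms χ) →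
    TExtended 𝒯 α χ → TEntails 𝒯 ψ χ ⇔ (ψ ⊨ₚ χ)
  TEntails⇔⊨ₚ ψ χ ψ⊆α χ⊆α χ-ext = mk⇔ (TEntails⇒⊨ₚ ψ χ ψ⊆α χ⊆α χ-ext) (⊨ₚ⇒TEntails ψ χ)

  TValid⇔PropValid : ∀ {α} (φ : Formula A) → All (_∈ α) (atoms φ) → TExtended 𝒯 α φ →
    TValid 𝒯 φ ⇔ PropValid φ
  TValid⇔PropValid φ φ⊆α φ-ext = mk⇔
    (λ valid v → TEntails⇒⊨ₚ ⊤ᶠ φ [] φ⊆α φ-ext (λ M _ → valid M) v _)
    (λ valid M → valid (holds M))

  TEquiv⇔≡ᴮ : ∀ {α} (φ₁ φ₂ : Formula A) → All (_∈ α) (atoms φ₁) → All (_∈ α) (atoms φ₂) →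
    TExtended 𝒯 α φ₁ → TExtended 𝒯 α φ₂ → TEquiv 𝒯 φ₁ φ₂ ⇔ (φ₁ ≡ᴮ φ₂)
  TEquiv⇔≡ᴮ φ₁ φ₂ φ₁⊆α φ₂⊆α φ₁-ext φ₂-ext = mk⇔
    (λ (φ₁⊨φ₂ , φ₂⊨φ₁) → TEntails⇒⊨ₚ φ₁ φ₂ φ₁⊆α φ₂⊆α φ₂-ext φ₁⊨φ₂
                        , TEntails⇒⊨ₚ φ₂ φ₁ φ₂⊆α φ₁⊆α φ₁-ext φ₂⊨φ₁)
    (λ (φ₁⊨φ₂ , φ₂⊨φ₁) → ⊨ₚ⇒TEntails φ₁ φ₂ φ₁⊨φ₂ , ⊨ₚ⇒TEntails φ₂ φ₁ φ₂⊨φ₁)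

theorem4p9 : {A : Set} (𝒯 : Theory A) → NoTrivialAtoms 𝒯 →
    (α : List A) (φ φ₁ φ₂ : Formula A) →
    All (_∈ α) (atoms φ) → All (_∈ α) (atoms φ₁) → All (_∈ α) (atoms φ₂) →
    TExtended 𝒯 α φ → TExtended 𝒯 α φ₁ → TExtended 𝒯 α φ₂ →
    (γ : List (A × Bool)) → CubeOn α γ →
    (TValid 𝒯 φ ⇔ PropValid φ)
    × (TEntails 𝒯 (cube γ) φ ⇔ (cube γ ⊨ₚ φ))
    × (TEquiv 𝒯 φ₁ φ₂ ⇔ (φ₁ ≡ᴮ φ₂))
    × (TEntails 𝒯 φ₁ φ₂ ⇔ (φ₁ ⊨ₚ φ₂))
theorem4p9 𝒯 _ α φ φ₁ φ₂ φ⊆α φ₁⊆α φ₂⊆α φ-ext φ₁-ext φ₂-ext γ γ-on =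
    TValid⇔PropValid 𝒯 φ φ⊆α φ-ext
  , TEntails⇔⊨ₚ 𝒯 (cube γ) φ (cube-atoms γ-on) φ⊆α φ-ext
  , TEquiv⇔≡ᴮ 𝒯 φ₁ φ₂ φ₁⊆α φ₂⊆α φ₁-ext φ₂-ext
  , TEntails⇔⊨ₚ 𝒯 φ₁ φ₂ φ₁⊆α φ₂⊆α φ₂-ext
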